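{- Let $D$ be an oriented graph, $k\geq 2$, and $v\in V(D)$ with $\{u_1,u_2,\ldots,u_k\}\subseteq N^-(v)$. Let $Y=\{u_1,\dots,u_k\}$. If $\widetilde{d}^-(u_1,u_2,\ldots,u_k)\rhd(k,k-1,\ldots,1)$, then $D$ contains a copy of $\overrightarrow{S_{k,1}}$ centered at $v$.
   Context: An oriented graph is a digraph obtained from a finite simple undirected graph by orienting each edge. $N^-(v)$ is the set of in-neighbors of $v$. For $Y=\{u_1,\dots,u_k\}\subseteq V(D)$, $\widetilde{d}^-(u_1,\dots,u_k)$ is the vector $(d^-_{V(D)\setminus Y}(u_1),\dots,d^-_{V(D)\setminus Y}(u_k))$, where $d^-_X(u)$ is the number of in-neighbors of $u$ lying in $X$. For nonnegative vectors $\mathbf{x}\in\mathbb{R}^s$, $\mathbf{y}\in\mathbb{R}^t$, write $x_{[1]}\ge\cdots\ge x_{[s]}$ for the entries of $\mathbf x$ in decreasing order; $\mathbf{x}\rhd\mathbf{y}$ ($\mathbf x$ covers $\mathbf y$) means $s\geq t$ and $x_{[i]}\geq y_{[i]}$ for all $1\le i\le t$. $\overrightarrow{S_{k,1}}$ centered at $v$ is the digraph with vertices $v$, $w_1,\dots,w_k$, $z_1,\dots,z_k$ and arcs $z_iw_i$, $w_iv$ ($i=1,\dots,k$); $D$ contains one centered at $v$ if it has a subgraph isomorphic to it with center mapped to $v$. -}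

module Defs where

open import Data.Nat using (ℕ; zero; suc; _+_; _∸_; _≤_; _≥_)
open import Data.Bool using (Bool; true; false; _∧_; not)
open import Data.Fin using (Fin; toℕ) renaming (_≤_ to _≤ᶠ_)
open import Data.Fin.Permutation using (Permutation′; _⟨$⟩ʳ_)
open import Data.Product using (Σ; _×_; ∃)
open import Relation.Binary.PropositionalEquality using (_≡_; _≢_)
open import Relation.Nullary using (¬_; does)
open import Data.Fin using (_≟_)
open import Function.Definitions using (Injective)

Digraph : ℕ → Set
Digraph n = Fin n → Fin n → Bool

IsOriented : ∀ {n} → Digraph n → Set
IsOriented {n} A = (∀ x → A x x ≡ false) × (∀ x y → A x y ≡ true → A y x ≡ false)

count : ∀ {n} → (Fin n → Bool) → ℕ
count {zero} p = 0
count {suc n} p = (if p Fin.zero then 1 else 0) + count {n} (λ i → p (Fin.suc i))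
  where
  open import Data.Bool using (if_then_else_)
  import Data.Fin as Fin

inImage : ∀ {n k} → (Fin k → Fin n) → Fin n → Bool
inImage {n} {k} u x = count (λ i → does (u i ≟ x)) ≥ᵇ 1
  where open import Data.Nat using () renaming (_≤ᵇ_ to _≤ᵇ'_)
        _≥ᵇ_ : ℕ → ℕ → Bool
        a ≥ᵇ b = b ≤ᵇ' a

inDegIn : ∀ {n} → Digraph n → (Fin n → Bool) → Fin n → ℕ
inDegIn A X y = count (λ x → X x ∧ A x y)

-- the vector  d̃^-(u_1,…,u_k) = (d^-_{V∖Y}(u_1), …, d^-_{V∖Y}(u_k)),  Y = {u_1,…,u_k}
dTilde : ∀ {n k} → Digraph n → (Fin k → Fin n) → Fin k → ℕ
dTilde A u i = inDegIn A (λ x → not (inImage u x)) (u i)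

-- σ lists the entries of x in (weakly) decreasing order: x_[i+1] = x (σ i)
IsDecreasingArrangement : ∀ {s} → (Fin s → ℕ) → Permutation′ s → Set
IsDecreasingArrangement x σ = ∀ i j → i ≤ᶠ j → x (σ ⟨$⟩ʳ j) ≤ x (σ ⟨$⟩ʳ i)

-- x ⊳ y  (x covers y): s ≥ t and x_[i] ≥ y_[i] for all 1 ≤ i ≤ t
_⊳_ : ∀ {s t} → (Fin s → ℕ) → (Fin t → ℕ) → Set
_⊳_ {s} {t} x y =
  t ≤ s ×
  Σ (Permutation′ s) λ σ → Σ (Permutation′ t) λ τ →
    IsDecreasingArrangement x σ × IsDecreasingArrangement y τ ×
    (∀ (i : Fin s) (j : Fin t) → toℕ i ≡ toℕ j → y (τ ⟨$⟩ʳ j) ≤ x (σ ⟨$⟩ʳ i))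

stair : (k : ℕ) → Fin k → ℕ
stair k j = k ∸ toℕ j

-- D contains a copy of S_{k,1} centred at v: vertices v, w_1..w_k, z_1..z_k pairwise
-- distinct (injective embedding) with arcs z_i w_i and w_i v.
ContainsSk1 : ∀ {n} → Digraph n → (k : ℕ) → Fin n → Set
ContainsSk1 {n} A k v =
  Σ (Fin k → Fin n) λ w → Σ (Fin k → Fin n) λ z →
    Injective _≡_ _≡_ w × Injective _≡_ _≡_ z ×
    (∀ i j → w i ≢ z j) × (∀ i → w i ≢ v) × (∀ i → z i ≢ v) ×
    (∀ i → A (z i) (w i) ≡ true) × (∀ i → A (w i) v ≡ true)

-- Take w_i = u_i. Each u_i has d̃⁻(u_i) in-neighbours outside Y, and the covering
-- hypothesis lets the u_i be reordered so that the j-th of them has at least k − j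
-- such in-neighbours. Choosing the z_i greedily from the last one to the first,
-- the j-th choice must avoid only the k − j − 1 vertices already taken, so a system
-- of distinct representatives exists. The z_i lie outside Y, hence differ from the
-- w_i, and the orientation forbids z_i = v because both u_i v and z_i u_i are arcs.
module Submission where

open import Defs
open import Data.Nat using (ℕ; zero; suc; _+_; _≤_; _<_; _∸_; z≤n; s≤s)
open import Data.Nat.Properties using (≤-refl; ≤-trans; ≤-pred; n≤1+n; ≤⇒≤ᵇ)
open import Data.Bool using (Bool; true; false; _∧_; not; if_then_else_)
open import Data.Bool.Properties using (∧-identityʳ; T-≡)
open import Data.Fin using (Fin; toℕ; _≟_)
import Data.Fin as Fin
open import Data.Fin.Permutation using (Permutation′; _⟨$⟩ʳ_; _⟨$⟩ˡ_; inverseʳ; flip; _∘ₚ_)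
open import Data.Product using (Σ; _×_; _,_)
open import Function using (_∘_; Injection; Equivalence)
open import Function.Properties.Inverse using (↔⇒↣)
import Function.Construct.Composition as Compose
open import Function.Definitions using (Injective)
open import Relation.Nullary using (does; no; contradiction)
open import Relation.Nullary.Decidable using (dec-true)
open import Relation.Binary.PropositionalEquality using (_≡_; _≢_; refl; sym; trans; cong; cong₂; subst)

private
  variable
    m n : ℕ

count-cong : {P Q : Fin n → Bool} → (∀ i → P i ≡ Q i) → count P ≡ count Q
count-cong {zero}  P≡Q = refl
count-cong {suc n} P≡Q = cong₂ _+_ (cong (λ b → if b then 1 else 0) (P≡Q Fin.zero))
                                   (count-cong (P≡Q ∘ Fin.suc))

count-pos⇒witness : (P : Fin n → Bool) → 1 ≤ count P → Σ (Fin n) λ y → P y ≡ true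
count-pos⇒witness {suc n} P pos with P Fin.zero in P0
... | true  = Fin.zero , P0
... | false with y , Py ← count-pos⇒witness (P ∘ Fin.suc) pos = Fin.suc y , Py

witness⇒count-pos : (P : Fin n → Bool) (y : Fin n) → P y ≡ true → 1 ≤ count P
witness⇒count-pos P Fin.zero    Py rewrite Py = s≤s z≤n
witness⇒count-pos P (Fin.suc y) Py with P Fin.zero
... | true  = s≤s z≤n
... | false = witness⇒count-pos (P ∘ Fin.suc) y Py

delete : (Fin n → Bool) → Fin n → Fin n → Bool
delete P a y = P y ∧ not (does (a ≟ y))

count≤suc-count-delete : (P : Fin n → Bool) (a : Fin n) → count P ≤ suc (count (delete P a))
count≤suc-count-delete {suc n} P Fin.zero
  rewrite count-cong {P = delete P Fin.zero ∘ Fin.suc} (λ _ → ∧-identityʳ _)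
  with P Fin.zero
... | true  = ≤-refl
... | false = n≤1+n _
count≤suc-count-delete {suc n} P (Fin.suc a) with P Fin.zero
... | true  = s≤s (count≤suc-count-delete (P ∘ Fin.suc) a)
... | false = count≤suc-count-delete (P ∘ Fin.suc) a

delete-sound : (P : Fin n → Bool) (a y : Fin n) → delete P a y ≡ true → P y ≡ true × a ≢ y
delete-sound P a y del with P y | a ≟ y
... | true  | no a≢y = refl , a≢y

avoiding : (x : Fin m → Fin n) (P : Fin n → Bool) → m < count P →
           Σ (Fin n) λ y → P y ≡ true × (∀ j → x j ≢ y)
avoiding {zero}  x P pos with y , Py ← count-pos⇒witness P pos = y , Py , λ ()
avoiding {suc m} x P large
  with y , P′y , avoids-tail ← avoiding (x ∘ Fin.suc) (delete P (x Fin.zero))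
                                 (≤-pred (≤-trans large (count≤suc-count-delete P (x Fin.zero))))
  with Py , x₀≢y ← delete-sound P (x Fin.zero) y P′y
  = y , Py , λ { Fin.zero → x₀≢y ; (Fin.suc j) → avoids-tail j }

DistinctRepresentatives : (Fin m → Fin n → Bool) → Set
DistinctRepresentatives {m} {n} S =
  Σ (Fin m → Fin n) λ x → Injective _≡_ _≡_ x × (∀ i → S i (x i) ≡ true)

distinct-representatives : (S : Fin m → Fin n → Bool) →
                           (∀ j → m ∸ toℕ j ≤ count (S j)) → DistinctRepresentatives S
distinct-representatives {zero}  S large = (λ ()) , (λ {}) , λ ()
distinct-representatives {suc m} S large
  with x , x-inj , x∈S ← distinct-representatives (S ∘ Fin.suc) (large ∘ Fin.suc)
  with y , y∈S , x≢y ← avoiding x (S Fin.zero) (large Fin.zero)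
  = extend , extend-inj , λ { Fin.zero → y∈S ; (Fin.suc j) → x∈S j }
  where
  extend : Fin (suc m) → Fin _
  extend Fin.zero    = y
  extend (Fin.suc j) = x j
  extend-inj : Injective _≡_ _≡_ extend
  extend-inj {Fin.zero}  {Fin.zero}  _ = refl
  extend-inj {Fin.zero}  {Fin.suc b} e = contradiction (sym e) (x≢y b)
  extend-inj {Fin.suc a} {Fin.zero}  e = contradiction e (x≢y a)
  extend-inj {Fin.suc a} {Fin.suc b} e = cong Fin.suc (x-inj e)

distinct-representatives-reindex : (S : Fin m → Fin n → Bool) (ρ : Permutation′ m) →
  DistinctRepresentatives (S ∘ (ρ ⟨$⟩ʳ_)) → DistinctRepresentatives S
distinct-representatives-reindex S ρ (x , x-inj , x∈S) =
  x ∘ (ρ ⟨$⟩ˡ_) ,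
  Compose.injective _≡_ _≡_ _≡_ (Injection.injective (↔⇒↣ (flip ρ))) x-inj ,
  λ i → subst (λ i′ → S i′ (x (ρ ⟨$⟩ˡ i)) ≡ true) (inverseʳ ρ) (x∈S (ρ ⟨$⟩ˡ i))

⊳⇒permuted-≤ : {x y : Fin m → ℕ} → x ⊳ y → Σ (Permutation′ m) λ ρ → ∀ j → y j ≤ x (ρ ⟨$⟩ʳ j)
⊳⇒permuted-≤ {x = x} {y} (_ , σ , τ , _ , _ , y≤x) =
  flip τ ∘ₚ σ ,
  λ j → subst (λ j′ → y j′ ≤ x (σ ⟨$⟩ʳ (τ ⟨$⟩ˡ j))) (inverseʳ τ) (y≤x (τ ⟨$⟩ˡ j) (τ ⟨$⟩ˡ j) refl)

inImage-self : (u : Fin m → Fin n) (i : Fin m) → inImage u (u i) ≡ true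
inImage-self u i = Equivalence.to T-≡
  (≤⇒≤ᵇ (witness⇒count-pos (λ t → does (u t ≟ u i)) i (dec-true (u i ≟ u i) refl)))

∧≡true⇒ : ∀ {a b} → a ∧ b ≡ true → a ≡ true × b ≡ true
∧≡true⇒ {true} {true} _ = refl , refl

not≡true⇒ : ∀ {a} → not a ≡ true → a ≡ false
not≡true⇒ {false} _ = refl

inNeighboursOutside : (A : Digraph n) (u : Fin m → Fin n) → Fin m → Fin n → Bool
inNeighboursOutside A u i y = not (inImage u y) ∧ A y (u i)

representatives⇒Sk1 : ∀ (A : Digraph n) → IsOriented A → (k : ℕ) (v : Fin n) →
  (u : Fin k → Fin n) → Injective _≡_ _≡_ u → (∀ i → A (u i) v ≡ true) →
  DistinctRepresentatives (inNeighboursOutside A u) → ContainsSk1 A k v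
representatives⇒Sk1 A (loopless , antisymmetric) k v u u-inj u→v (z , z-inj , z∈C) =
  u , z , u-inj , z-inj , u≢z , u≢v , z≢v , z→u , u→v
  where
  z→u : ∀ i → A (z i) (u i) ≡ true
  z→u i with _ , arc ← ∧≡true⇒ (z∈C i) = arc
  z∉Y : ∀ j → inImage u (z j) ≡ false
  z∉Y j with outside , _ ← ∧≡true⇒ (z∈C j) = not≡true⇒ outside
  u≢z : ∀ i j → u i ≢ z j
  u≢z i j ui≡zj with () ← trans (sym (subst (λ y → inImage u y ≡ true) ui≡zj (inImage-self u i)))
                               (z∉Y j)
  u≢v : ∀ i → u i ≢ v
  u≢v i ui≡v with () ← trans (sym (loopless v)) (subst (λ y → A y v ≡ true) ui≡v (u→v i))
  z≢v : ∀ i → z i ≢ v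
  z≢v i zi≡v with () ← trans (sym (antisymmetric (u i) v (u→v i)))
                             (subst (λ y → A y (u i) ≡ true) zi≡v (z→u i))

lemma2p2 : ∀ {n} (A : Digraph n) → IsOriented A →
    (k : ℕ) → 2 ≤ k → (v : Fin n) →
    (u : Fin k → Fin n) → Injective _≡_ _≡_ u → (∀ i → A (u i) v ≡ true) →
    dTilde A u ⊳ stair k →
    ContainsSk1 A k v
lemma2p2 A oriented k _ v u u-inj u→v cover
  with ρ , stair≤d̃ ← ⊳⇒permuted-≤ {x = dTilde A u} cover
  = representatives⇒Sk1 A oriented k v u u-inj u→v
      (distinct-representatives-reindex (inNeighboursOutside A u) ρ
        (distinct-representatives (inNeighboursOutside A u ∘ (ρ ⟨$⟩ʳ_)) stair≤d̃))
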